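{- Let $n\ge 1$, let $r\in[n]=\{1,\dots,n\}$, and let $\lambda=1^{e_1}2^{e_2}\cdots$ be an integer partition of $n-1$ with length $\ell(\lambda)=\sum_{i\ge1}e_i$. Then there is a bijection between $\mathcal{T}^{(r)}_{n,\lambda}$ and $\Pi_{n,\lambda}\times\mathcal{S}^{(r)}_{n,\ell(\lambda)}$.
   Context: A rooted labeled tree on $[n]$ rooted at $r$ carries the global orientation, in which every edge is oriented towards the root; so the global indegree of a vertex is its number of children. The global indegree sequence of such a tree is the integer partition $1^{e_1}2^{e_2}\cdots$, where $e_i$ is the number of vertices of global indegree $i$ ($i\ge1$); it is a partition of $n-1$. $\mathcal{T}^{(r)}_{n,\lambda}$ is the set of labeled trees on $[n]$ rooted at $r$ whose global indegree sequence is $\lambda$. The type of a set partition is the integer partition $1^{e_1}2^{e_2}\cdots$, where $e_i$ is the number of blocks of size $i$. $\Pi_{n,\lambda}$ is the set of set partitions of a fixed $(n-1)$-element set whose type is $\lambda$. For $k\in[n]$, $\mathcal{S}^{(r)}_{n,k}$ is the set of $k$-permutations of $[n]$ with last entry $r$, i.e. sequences $(p_1,\dots,p_k)$ of $k$ distinct elements of $[n]$ with $p_k=r$. -}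

module Defs where

open import Data.Nat using (ℕ; zero; suc; _≤_; _≥_; _∸_)
import Data.Nat as ℕ
open import Data.Bool using (Bool; T)
open import Data.Fin using (Fin)
import Data.Fin as Fin
open import Data.Fin.Subset using (Subset; ∣_∣)
open import Data.List using (List; length; filter; allFin; deduplicate)
open import Data.Nat.ListAction using (sum)
open import Data.List.Relation.Unary.All using (All)
open import Data.List.Relation.Unary.Linked using (Linked)
open import Data.Vec using (Vec; []; _∷_; lookup; toList)
open import Data.Vec.Properties using (≡-dec)
import Data.Bool as Bool
open import Data.Vec.Relation.Unary.Unique.Propositional using (Unique)
open import Data.Product using (Σ; _×_; proj₁)
open import Data.Unit using (⊤)
open import Relation.Nullary using (¬_; ¬?)
open import Relation.Nullary.Decidable using (_×-dec_)
open import Relation.Binary.PropositionalEquality using (_≡_; _≢_; setoid)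
open import Relation.Binary.Bundles using (Setoid)
import Relation.Binary.Construct.On as On
open import Data.Product.Relation.Binary.Pointwise.NonDependent using (×-setoid)

IsPartitionOf : List ℕ → ℕ → Set
IsPartitionOf λ' m = All (1 ≤_) λ' × Linked _≥_ λ' × sum λ' ≡ m

mult : ℕ → List ℕ → ℕ
mult i λ' = length (filter (ℕ._≟ i) λ')

len : List ℕ → ℕ
len = length

-- Rooted labeled trees on [n] = Fin n, rooted at r, given by their
-- parent map (every edge oriented towards the root).  The root is its
-- own "parent" (a dummy value); every vertex reaches r by following
-- parents (so, discarding the root's self-loop, the n-1 edges
-- v → parent v, v ≠ r, form a tree with all edges oriented to r).

iter : ∀ {A : Set} → (A → A) → ℕ → A → A
iter f zero    x = x
iter f (suc k) x = iter f k (f x)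

IsRootedTree : (n : ℕ) → Fin n → Vec (Fin n) n → Set
IsRootedTree n r par = (lookup par r ≡ r) × (∀ v → iter (lookup par) n v ≡ r)

indeg : ∀ {n} → Fin n → Vec (Fin n) n → Fin n → ℕ
indeg {n} r par v =
  length (filter (λ u → ¬? (u Fin.≟ r) ×-dec (lookup par u Fin.≟ v)) (allFin n))

indegMult : ∀ {n} → Fin n → Vec (Fin n) n → ℕ → ℕ
indegMult {n} r par i = length (filter (λ v → indeg r par v ℕ.≟ i) (allFin n))

Trees : (n : ℕ) → Fin n → List ℕ → Set
Trees n r λ' = Σ (Vec (Fin n) n) λ par →
  IsRootedTree n r par × (∀ i → 1 ≤ i → indegMult r par i ≡ mult i λ')

-- Set partitions of Fin m, given by their equivalence relation
-- (a Boolean m×m matrix); blocks = equivalence classes (rows).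

Rel? : ∀ {m} → Vec (Vec Bool m) m → Fin m → Fin m → Set
Rel? R x y = T (lookup (lookup R x) y)

IsEquivRel : ∀ {m} → Vec (Vec Bool m) m → Set
IsEquivRel R = (∀ x → Rel? R x x)
             × (∀ x y → Rel? R x y → Rel? R y x)
             × (∀ x y z → Rel? R x y → Rel? R y z → Rel? R x z)

blocks : ∀ {m} → Vec (Vec Bool m) m → List (Subset m)
blocks R = deduplicate (≡-dec Bool._≟_) (toList R)

blockMult : ∀ {m} → Vec (Vec Bool m) m → ℕ → ℕ
blockMult R i = length (filter (λ B → ∣ B ∣ ℕ.≟ i) (blocks R))

SetPartitions : (n : ℕ) → List ℕ → Set
SetPartitions n λ' = Σ (Vec (Vec Bool (n ∸ 1)) (n ∸ 1)) λ R →
  IsEquivRel R × (∀ i → 1 ≤ i → blockMult R i ≡ mult i λ')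

LastIs : ∀ {n k} → Vec (Fin n) k → Fin n → Set
LastIs []           r = ⊤          -- convention for k = 0 (only when n = 1)
LastIs (x ∷ [])     r = x ≡ r
LastIs (x ∷ y ∷ ys) r = LastIs (y ∷ ys) r

KPerms : (n : ℕ) → Fin n → ℕ → Set
KPerms n r k = Σ (Vec (Fin n) k) λ p → Unique p × LastIs p r

Trees-setoid : (n : ℕ) → Fin n → List ℕ → Setoid _ _
Trees-setoid n r λ' = On.setoid {B = Trees n r λ'} (setoid _) proj₁

SetPartitions-setoid : (n : ℕ) → List ℕ → Setoid _ _
SetPartitions-setoid n λ' = On.setoid {B = SetPartitions n λ'} (setoid _) proj₁

KPerms-setoid : (n : ℕ) → Fin n → ℕ → Setoid _ _
KPerms-setoid n r k = On.setoid {B = KPerms n r k} (setoid _) proj₁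

module Submission where

-- Theorem 1.2.  Write n = m + 1 and identify the non-root vertices with Fin m
-- via ι = punchIn r, so that a tree is its parent map q : Fin m → Fin n.
-- The bijection sends q to
--   * its sibling partition x ~ y ⇔ q x ≡ q y, whose blocks are the children
--     sets of the internal vertices: its type is the indegree sequence λ and it
--     has ℓ = ℓ(λ) blocks;
--   * a pruning sequence: repeatedly take the first unpruned x whose sibling
--     block contains no parent of an unpruned vertex, output q x and prune the
--     block.  Each internal vertex is output once, the root last.
-- The inverse reads v₁ … v_ℓ and gives parent vᵢ to the first unassigned block
-- none of whose members occurs among vᵢ … v_ℓ.

open import Defs
open import Data.Nat as ℕ using (ℕ; zero; suc; _+_; _≤_; _<_; z≤n; s≤s; _∸_)
open import Data.Nat.Properties
  using ( ≤-trans; ≤-antisym; ≤-refl; ≤-reflexive; n≤1+n; m≤m+n; m≤n+m; +-suc; suc-injective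
        ; <-irrefl; ≤-pred; ≤∧≢⇒<; m+[n∸m]≡n; +-commutativeSemigroup; module ≤-Reasoning)
open import Data.Nat.ListAction using (sum)
open import Data.Bool using (Bool; true; false; T; not; _∧_; _∨_; if_then_else_)
open import Data.Bool.Properties
  using (T-≡; ∧-conicalˡ; ∧-conicalʳ; ∧-zeroʳ; ∧-identityʳ; ∨-zeroʳ; not-injective; not-¬)
import Data.Bool as Bool
open import Data.Unit using (tt)
open import Data.Empty using (⊥; ⊥-elim)
open import Data.Sum using (_⊎_; inj₁; inj₂)
open import Data.Fin using (Fin; zero; suc; punchIn; punchOut)
open import Data.Fin.Properties
  using (punchInᵢ≢i; punchIn-injective; punchIn-punchOut; punchOut-punchIn; punchOut-cong)
  renaming (_≟_ to _≟F_)
open import Data.Fin.Subset using (Subset; ∣_∣)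
open import Data.Fin.Subset.Properties using (∣p∣≤n)
open import Data.Maybe using (Maybe; just; nothing; maybe′; fromMaybe; is-nothing)
import Data.Maybe.Properties as MaybeP
open import Data.Vec using (Vec; []; _∷_; toList; lookup; tabulate)
open import Data.Vec.Properties using (≡-dec; tabulate∘lookup; tabulate-cong; lookup∘tabulate; length-toList)
import Data.Vec.Relation.Unary.Unique.Propositional as VecUnique
import Data.Vec.Relation.Unary.AllPairs as VecAllPairs
import Data.Vec.Relation.Unary.All.Properties as VecAllP
open import Data.List using (List; []; _∷_; length; map; filter; allFin)
import Data.List as List
open import Data.List.Properties using (length-map; length-filter; length-tabulate)
open import Data.List.Membership.Propositional using (_∈_)
open import Data.List.Membership.Propositional.Properties
  using (∈-filter⁺; ∈-filter⁻; ∈-allFin; ∈-map⁻; ∈-map⁺; ∈-deduplicate⁺; ∈-deduplicate⁻)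
open import Data.List.Relation.Unary.Any using (here; there)
open import Data.List.Relation.Unary.All as All using (All; []; _∷_)
import Data.List.Relation.Unary.All.Properties as AllP
open import Data.List.Relation.Unary.AllPairs using ([]; _∷_)
open import Data.List.Relation.Unary.Unique.Propositional using (Unique)
import Data.List.Relation.Unary.Unique.Propositional.Properties as UniqueP
import Data.List.Relation.Unary.Unique.DecPropositional.Properties as DecUniqueP
open import Data.Product using (Σ; _×_; _,_; proj₁; proj₂)
open import Relation.Nullary using (yes; no; Dec; does; ¬?)
open import Relation.Nullary.Decidable using (T?; _×-dec_)
open import Relation.Binary.PropositionalEquality
open import Relation.Binary.Definitions using (DecidableEquality)
open import Function.Bundles using (Inverse; Equivalence)
open import Data.Product.Relation.Binary.Pointwise.NonDependent using (×-setoid)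
open import Algebra.Properties.CommutativeSemigroup +-commutativeSemigroup
  using () renaming (interchange to +-interchange)
import Data.Vec.Membership.Propositional.Properties as VecMem
import Data.Vec.Relation.Unary.Any as VecAny
import Data.Vec.Relation.Unary.Any.Properties as VecAnyP

toT : ∀ {b} → b ≡ true → T b
toT = Equivalence.from T-≡

fromT : ∀ {b} → T b → b ≡ true
fromT = Equivalence.to T-≡

true≢false : ∀ {b} → b ≡ true → b ≡ false → ⊥
true≢false e = not-¬ e

∧-true : ∀ {a b} → a ∧ b ≡ true → a ≡ true × b ≡ true
∧-true e = ∧-conicalˡ _ _ e , ∧-conicalʳ _ _ e

∧-intro : ∀ {a b} → a ≡ true → b ≡ true → a ∧ b ≡ true
∧-intro refl refl = refl

not-true : ∀ {b} → not b ≡ true → b ≡ false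
not-true = not-injective

∨-case : ∀ {a b} → a ∨ b ≡ true → a ≡ true ⊎ b ≡ true
∨-case {true} _ = inj₁ refl
∨-case {false} e = inj₂ e

bool-iff : ∀ {a b} → (a ≡ true → b ≡ true) → (b ≡ true → a ≡ true) → a ≡ b
bool-iff {true} {true} f g = refl
bool-iff {false} {false} f g = refl
bool-iff {true} {false} f g = sym (f refl)
bool-iff {false} {true} f g = g refl

eqF : ∀ {k} → Fin k → Fin k → Bool
eqF a b = does (a ≟F b)

eqF-refl : ∀ {k} (a : Fin k) → eqF a a ≡ true
eqF-refl a with a ≟F a
... | yes _ = refl
... | no ne = ⊥-elim (ne refl)

eqF-true : ∀ {k} {a b : Fin k} → eqF a b ≡ true → a ≡ b
eqF-true {a = a} {b} e with a ≟F b
... | yes p = p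

eqF-sym : ∀ {k} (a b : Fin k) → eqF a b ≡ eqF b a
eqF-sym a b with a ≟F b | b ≟F a
... | yes _ | yes _ = refl
... | no _ | no _ = refl
... | yes p | no ne = ⊥-elim (ne (sym p))
... | no ne | yes p = ⊥-elim (ne (sym p))

module _ {A : Set} (_≟_ : DecidableEquality A) where

  delete : A → List A → List A
  delete x [] = []
  delete x (y ∷ ys) with x ≟ y
  ... | yes _ = delete x ys
  ... | no _ = y ∷ delete x ys

  length-delete-≤ : ∀ x ys → length (delete x ys) ≤ length ys
  length-delete-≤ x [] = z≤n
  length-delete-≤ x (y ∷ ys) with x ≟ y
  ... | yes _ = ≤-trans (length-delete-≤ x ys) (n≤1+n _)
  ... | no _ = s≤s (length-delete-≤ x ys)

  length-delete-< : ∀ {x ys} → x ∈ ys → suc (length (delete x ys)) ≤ length ys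
  length-delete-< {x} {y ∷ ys} (here refl) with x ≟ y
  ... | yes _ = s≤s (length-delete-≤ x ys)
  ... | no ne = ⊥-elim (ne refl)
  length-delete-< {x} {y ∷ ys} (there x∈) with x ≟ y
  ... | yes _ = ≤-trans (length-delete-< x∈) (n≤1+n _)
  ... | no _ = s≤s (length-delete-< x∈)

  ∈-delete : ∀ {x z ys} → z ∈ ys → x ≢ z → z ∈ delete x ys
  ∈-delete {x} {z} {y ∷ ys} (here refl) ne with x ≟ y
  ... | yes e = ⊥-elim (ne e)
  ... | no _ = here refl
  ∈-delete {x} {z} {y ∷ ys} (there z∈) ne with x ≟ y
  ... | yes _ = ∈-delete z∈ ne
  ... | no _ = there (∈-delete z∈ ne)

  unique-⊆⇒length-≤ : ∀ {xs ys} → Unique xs → (∀ {z} → z ∈ xs → z ∈ ys) → length xs ≤ length ys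
  unique-⊆⇒length-≤ {[]} _ _ = z≤n
  unique-⊆⇒length-≤ {x ∷ xs} {ys} (x∉xs ∷ uxs) xs⊆ys =
    ≤-trans (s≤s (unique-⊆⇒length-≤ uxs (λ z∈ → ∈-delete (xs⊆ys (there z∈)) (All.lookup x∉xs z∈))))
            (length-delete-< (xs⊆ys (here refl)))

  unique-≈⇒length-≡ : ∀ {xs ys} → Unique xs → Unique ys
                    → (∀ {z} → z ∈ xs → z ∈ ys) → (∀ {z} → z ∈ ys → z ∈ xs) → length xs ≡ length ys
  unique-≈⇒length-≡ uxs uys xs⊆ys ys⊆xs = ≤-antisym (unique-⊆⇒length-≤ uxs xs⊆ys) (unique-⊆⇒length-≤ uys ys⊆xs)

map-unique : ∀ {A B : Set} (f : A → B) {xs : List A} → Unique xs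
           → (∀ {a b} → a ∈ xs → b ∈ xs → f a ≡ f b → a ≡ b) → Unique (map f xs)
map-unique f {[]} _ _ = []
map-unique f {x ∷ xs} (x∉xs ∷ uxs) inj =
  AllP.map⁺ (All.tabulate (λ {z} z∈ eq → All.lookup x∉xs z∈ (inj (here refl) (there z∈) eq)))
  ∷ map-unique f uxs (λ a∈ b∈ → inj (there a∈) (there b∈))

satisfying : ∀ {k} → (Fin k → Bool) → List (Fin k)
satisfying {k} P = filter (λ x → T? (P x)) (allFin k)

count : ∀ {k} → (Fin k → Bool) → ℕ
count P = length (satisfying P)

∈-satisfying⁺ : ∀ {k} {P : Fin k → Bool} {x} → P x ≡ true → x ∈ satisfying P
∈-satisfying⁺ {P = P} {x} e = ∈-filter⁺ (λ x → T? (P x)) (∈-allFin x) (toT e)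

∈-satisfying⁻ : ∀ {k} {P : Fin k → Bool} {x} → x ∈ satisfying P → P x ≡ true
∈-satisfying⁻ {k} {P} x∈ = fromT (proj₂ (∈-filter⁻ (λ x → T? (P x)) {xs = allFin k} x∈))

satisfying-unique : ∀ {k} (P : Fin k → Bool) → Unique (satisfying P)
satisfying-unique {k} P = UniqueP.filter⁺ (λ x → T? (P x)) (UniqueP.allFin⁺ k)

count-injection : ∀ {k j} {P : Fin k → Bool} {Q : Fin j → Bool} (f : Fin k → Fin j)
                → (∀ x → P x ≡ true → Q (f x) ≡ true)
                → (∀ x y → P x ≡ true → P y ≡ true → f x ≡ f y → x ≡ y)
                → count P ≤ count Q
count-injection {P = P} {Q} f maps inj =
  ≤-trans (≤-reflexive (sym (length-map f (satisfying P))))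
    (unique-⊆⇒length-≤ _≟F_
      (map-unique f (satisfying-unique P) (λ a∈ b∈ → inj _ _ (∈-satisfying⁻ a∈) (∈-satisfying⁻ b∈)))
      (λ z∈ → let (x , x∈ , e) = ∈-map⁻ f z∈
              in subst (_∈ satisfying Q) (sym e) (∈-satisfying⁺ (maps x (∈-satisfying⁻ x∈)))))

count-pos : ∀ {k} {P : Fin k → Bool} {c} → P c ≡ true → 1 ≤ count P
count-pos {c = c} e = unique-⊆⇒length-≤ _≟F_ {c ∷ []} ([] ∷ []) (λ { (here refl) → ∈-satisfying⁺ e })

count-single : ∀ {k} {P : Fin k → Bool} {c} → P c ≡ true → (∀ y → P y ≡ true → y ≡ c) → count P ≡ 1
count-single {P = P} {c} e u = sym (unique-≈⇒length-≡ _≟F_ {c ∷ []} ([] ∷ []) (satisfying-unique P)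
  (λ { (here refl) → ∈-satisfying⁺ e }) (λ z∈ → here (u _ (∈-satisfying⁻ z∈))))

count-cong : ∀ {k} {P Q : Fin k → Bool} → (∀ x → P x ≡ Q x) → count P ≡ count Q
count-cong {P = P} {Q} h = unique-≈⇒length-≡ _≟F_ (satisfying-unique P) (satisfying-unique Q)
  (λ z∈ → ∈-satisfying⁺ (trans (sym (h _)) (∈-satisfying⁻ z∈)))
  (λ z∈ → ∈-satisfying⁺ (trans (h _) (∈-satisfying⁻ z∈)))

count-split : ∀ {k} (P Q : Fin k → Bool) → count P ≡ count (λ x → P x ∧ Q x) + count (λ x → P x ∧ not (Q x))
count-split {k} P Q = go (allFin k)
  where
    filt : (Fin k → Bool) → List (Fin k) → ℕ
    filt B xs = length (filter (λ x → T? (B x)) xs)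
    go : ∀ xs → filt P xs ≡ filt (λ x → P x ∧ Q x) xs + filt (λ x → P x ∧ not (Q x)) xs
    go [] = refl
    go (x ∷ xs) with P x | Q x
    ... | true | true = cong suc (go xs)
    ... | true | false = trans (cong suc (go xs)) (sym (+-suc _ _))
    ... | false | true = go xs
    ... | false | false = go xs

count-≤ : ∀ {k} (P : Fin k → Bool) → count P ≤ k
count-≤ {k} P = ≤-trans (length-filter (λ x → T? (P x)) (allFin k)) (≤-reflexive (length-tabulate {n = k} (λ x → x)))

count-zero : ∀ {k} {P : Fin k → Bool} → (∀ x → P x ≡ false) → count P ≡ 0
count-zero {P = P} h = ≤-antisym (unique-⊆⇒length-≤ _≟F_ {satisfying P} {[]} (satisfying-unique P)
  (λ z∈ → ⊥-elim (true≢false (∈-satisfying⁻ z∈) (h _)))) z≤n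

-- First index satisfying a Boolean predicate; all choices made by the
-- encoder and the decoder are "the first candidate".

first : ∀ {k} → (Fin k → Bool) → Maybe (Fin k)
first {zero} P = nothing
first {suc k} P with P zero
... | true = just zero
... | false = Data.Maybe.map suc (first (λ x → P (suc x)))

first-cong : ∀ {k} {P Q : Fin k → Bool} → (∀ x → P x ≡ Q x) → first P ≡ first Q
first-cong {zero} h = refl
first-cong {suc k} {P} {Q} h with P zero | Q zero | h zero
... | true | true | _ = refl
... | false | false | _ = cong (Data.Maybe.map suc) (first-cong (λ x → h (suc x)))

first-sound : ∀ {k} {P : Fin k → Bool} {x} → first P ≡ just x → P x ≡ true
first-sound {suc k} {P} {x} e with P zero in eq
first-sound {suc k} {P} {.zero} refl | true = eq
first-sound {suc k} {P} {x} e | false with first (λ x → P (suc x)) in e2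
first-sound {suc k} {P} {.(suc y)} refl | false | just y = first-sound e2

first-none : ∀ {k} {P : Fin k → Bool} → first P ≡ nothing → ∀ x → P x ≡ false
first-none {suc k} {P} e x with P zero in eq
first-none {suc k} {P} () x | true
first-none {suc k} {P} e x | false with first (λ x → P (suc x)) in e2
first-none {suc k} {P} e zero | false | nothing = eq
first-none {suc k} {P} e (suc x) | false | nothing = first-none e2 x

first-some : ∀ {k} {P : Fin k → Bool} {x} → P x ≡ true → Σ (Fin k) λ c → first P ≡ just c
first-some {P = P} {x} px with first P in e
... | just c = c , refl
... | nothing with () ← trans (sym (first-none e x)) px

count-witness : ∀ {k} {P : Fin k → Bool} {n} → count P ≡ suc n → Σ (Fin k) λ x → P x ≡ true
count-witness {P = P} e with first P in e2
... | just x = x , first-sound e2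
... | nothing with () ← trans (sym e) (count-zero (first-none e2))

any : ∀ {k} → (Fin k → Bool) → Bool
any P = maybe′ (λ _ → true) false (first P)

any-witness : ∀ {k} {P : Fin k → Bool} → any P ≡ true → Σ (Fin k) λ x → P x ≡ true
any-witness {P = P} e with first P in e2
... | just x = x , first-sound e2

any-intro : ∀ {k} {P : Fin k → Bool} {x} → P x ≡ true → any P ≡ true
any-intro {P = P} px with first-some {P = P} px
... | c , e rewrite e = refl

any-cong : ∀ {k} {P Q : Fin k → Bool} → (∀ x → P x ≡ Q x) → any P ≡ any Q
any-cong h = cong (maybe′ (λ _ → true) false) (first-cong h)

memV : ∀ {k j} → Fin k → Vec (Fin k) j → Bool
memV v [] = false
memV v (w ∷ s) = eqF v w ∨ memV v s

memV-sound : ∀ {k j} {v : Fin k} {s : Vec (Fin k) j} → memV v s ≡ true → v ∈ toList s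
memV-sound {v = v} {w ∷ s} e with v ≟F w
... | yes refl = here refl
... | no _ = there (memV-sound e)

memV-complete : ∀ {k j} {v : Fin k} {s : Vec (Fin k) j} → v ∈ toList s → memV v s ≡ true
memV-complete {v = v} {w ∷ s} (here refl) rewrite eqF-refl v = refl
memV-complete {v = v} {w ∷ s} (there v∈) rewrite memV-complete {v = v} {s} v∈ = ∨-zeroʳ _

memV-head : ∀ {k j} (v : Fin k) (s : Vec (Fin k) j) → memV v (v ∷ s) ≡ true
memV-head v s rewrite eqF-refl v = refl

memV-there : ∀ {k j} {u : Fin k} {s : Vec (Fin k) j} (w : Fin k) → memV u s ≡ true → memV u (w ∷ s) ≡ true
memV-there {u = u} w e = trans (cong (eqF u w ∨_) e) (∨-zeroʳ _)

-- Boolean-valued equivalence relations and block leaders: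
-- the leader of x is the first element of its block, so blocks
-- correspond one-to-one to leaders.

record IsEqR {m} (R : Fin m → Fin m → Bool) : Set where
  field
    rfl : ∀ x → R x x ≡ true
    sy : ∀ x y → R x y ≡ true → R y x ≡ true
    tr : ∀ x y z → R x y ≡ true → R y z ≡ true → R x z ≡ true

module Leaders {m} (R : Fin m → Fin m → Bool) (E : IsEqR R) where
  open IsEqR E

  R-row : ∀ {x y} → R x y ≡ true → ∀ z → R x z ≡ R y z
  R-row {x} {y} rxy z = bool-iff (tr y x z (sy x y rxy)) (tr x y z rxy)

  leader : Fin m → Fin m
  leader x = fromMaybe x (first (R x))

  leader-R : ∀ x → R x (leader x) ≡ true
  leader-R x with first-some {P = R x} (rfl x)
  ... | c , e rewrite e = first-sound e

  leader-cong : ∀ {x y} → R x y ≡ true → leader x ≡ leader y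
  leader-cong {x} {y} rxy with first-some {P = R y} (rfl y)
  ... | c , e = begin
    fromMaybe x (first (R x)) ≡⟨ cong (fromMaybe x) (first-cong (R-row rxy)) ⟩
    fromMaybe x (first (R y)) ≡⟨ cong (fromMaybe x) e ⟩
    c                         ≡⟨ cong (fromMaybe y) e ⟨
    fromMaybe y (first (R y)) ∎
    where open ≡-Reasoning

  isLeader : Fin m → Bool
  isLeader y = eqF (leader y) y

  isLeader-leader : ∀ x → isLeader (leader x) ≡ true
  isLeader-leader x rewrite sym (leader-cong (leader-R x)) = eqF-refl (leader x)

  isLeader-unique : ∀ {x y} → isLeader y ≡ true → R x y ≡ true → y ≡ leader x
  isLeader-unique {x} {y} ly rxy = trans (sym (eqF-true ly)) (sym (leader-cong rxy))

  isLeader-injective : ∀ {x y} → isLeader x ≡ true → isLeader y ≡ true → R x y ≡ true → x ≡ y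
  isLeader-injective {x} {y} lx ly rxy = trans (sym (eqF-true lx)) (trans (leader-cong rxy) (eqF-true ly))

  -- within a set S closed under R, the block of an element x ∈ S contains
  -- exactly one leader, so removing the block lowers the leader count by one
  leaders-remove-block : (S : Fin m → Bool) {x : Fin m} → S x ≡ true → (∀ y z → R y z ≡ true → S y ≡ S z)
    → count (λ y → S y ∧ isLeader y) ≡ suc (count (λ y → (S y ∧ not (R x y)) ∧ isLeader y))
  leaders-remove-block S {x} sx closed = begin
    count SL                                              ≡⟨ count-split SL (R x) ⟩
    count (λ y → SL y ∧ R x y) + count (λ y → SL y ∧ not (R x y))
                                                          ≡⟨ cong₂ _+_ leader-only (count-cong rearrange) ⟩
    suc (count (λ y → (S y ∧ not (R x y)) ∧ isLeader y))  ∎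
    where
      open ≡-Reasoning
      SL = λ y → S y ∧ isLeader y
      leader-only : count (λ y → SL y ∧ R x y) ≡ 1
      leader-only = count-single {c = leader x}
        (∧-intro (∧-intro (trans (closed (leader x) x (sy x (leader x) (leader-R x))) sx) (isLeader-leader x)) (leader-R x))
        (λ y e → let (sly , rxy) = ∧-true e in isLeader-unique (proj₂ (∧-true sly)) rxy)
      rearrange : ∀ y → SL y ∧ not (R x y) ≡ (S y ∧ not (R x y)) ∧ isLeader y
      rearrange y with S y | R x y | isLeader y
      ... | true | true | b = ∧-zeroʳ b
      ... | true | false | b = ∧-identityʳ b
      ... | false | _ | _ = refl

iter-suc : ∀ {A : Set} (f : A → A) k x → iter f (suc k) x ≡ f (iter f k x)
iter-suc f zero x = refl
iter-suc f (suc k) x = iter-suc f k (f x)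

iter-fix : ∀ {A : Set} (f : A → A) k a → f a ≡ a → iter f k a ≡ a
iter-fix f zero a e = refl
iter-fix f (suc k) a e rewrite e = iter-fix f k a e

iter-+ : ∀ {A : Set} (f : A → A) a b x → iter f (a + b) x ≡ iter f b (iter f a x)
iter-+ f zero b x = refl
iter-+ f (suc a) b x = iter-+ f a b (f x)

iter-cong : ∀ {A : Set} {f g : A → A} → (∀ x → f x ≡ g x) → ∀ k x → iter f k x ≡ iter g k x
iter-cong h zero x = refl
iter-cong {f = f} {g} h (suc k) x = trans (cong (iter f k) (h x)) (iter-cong h k (g x))

-- The vertex set Fin (suc m) with root r; the non-root vertices are
-- ι y for y : Fin m.  A parent map on non-root vertices Q : Fin m → V
-- extends to all vertices by sending the root to itself.

module Vertices (m : ℕ) (r : Fin (suc m)) where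
  V = Fin (suc m)

  ι : Fin m → V
  ι = punchIn r

  ι≢r : ∀ y → ι y ≢ r
  ι≢r y = punchInᵢ≢i r y

  ι-or-r : ∀ v → v ≡ r ⊎ Σ (Fin m) λ w → v ≡ ι w
  ι-or-r v with r ≟F v
  ... | yes e = inj₁ (sym e)
  ... | no ne = inj₂ (punchOut ne , sym (punchIn-punchOut ne))

  extend : (Fin m → V) → V → V
  extend Q v with r ≟F v
  ... | yes _ = r
  ... | no ne = Q (punchOut ne)

  extend-r : ∀ Q → extend Q r ≡ r
  extend-r Q with r ≟F r
  ... | yes _ = refl
  ... | no ne = ⊥-elim (ne refl)

  extend-ι : ∀ Q y → extend Q (ι y) ≡ Q y
  extend-ι Q y with r ≟F ι y
  ... | yes e = ⊥-elim (ι≢r y (sym e))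
  ... | no ne = cong Q (trans (punchOut-cong r refl) (punchOut-punchIn r))

  iter-extend-r : ∀ Q k → iter (extend Q) k r ≡ r
  iter-extend-r Q k = iter-fix (extend Q) k r (extend-r Q)

  lastIs-tail : ∀ {k} v (s : Vec V k) → LastIs (v ∷ s) r → LastIs s r
  lastIs-tail v [] _ = tt
  lastIs-tail v (w ∷ s) l = l

  lastIs-∈ : ∀ {k} v (s : Vec V k) → LastIs (v ∷ s) r → r ∈ toList (v ∷ s)
  lastIs-∈ v [] refl = here refl
  lastIs-∈ v (w ∷ s) l = there (lastIs-∈ w s l)

  nonroot-count : ∀ {k} (s : Vec V k) → Unique (toList s) → r ∈ toList s
                → suc (count (λ y → memV (ι y) s)) ≤ k
  nonroot-count {k} s us r∈ = begin
    suc (count F)                    ≡⟨ cong suc (length-map ι (satisfying F)) ⟨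
    length (r ∷ map ι (satisfying F)) ≤⟨ unique-⊆⇒length-≤ _≟F_ unique sub ⟩
    length (toList s)                ≡⟨ length-toList s ⟩
    k                                ∎
    where
      open ≤-Reasoning
      F = λ y → memV (ι y) s
      unique : Unique (r ∷ map ι (satisfying F))
      unique = All.tabulate (λ z∈ e → let (w , _ , e2) = ∈-map⁻ ι z∈ in ι≢r w (sym (trans e e2)))
               ∷ map-unique ι (satisfying-unique F) (λ _ _ → punchIn-injective r _ _)
      sub : ∀ {z} → z ∈ r ∷ map ι (satisfying F) → z ∈ toList s
      sub (here refl) = r∈
      sub (there z∈) = let (w , w∈ , e) = ∈-map⁻ ι z∈ in subst (_∈ toList s) (sym e) (memV-sound (∈-satisfying⁻ w∈))

-- U is the set of unpruned
-- non-root vertices; a vertex x ∈ U is prunable when no sibling of x is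
-- the parent of a vertex of U.

module Encoding (m : ℕ) (r : Fin (suc m)) (q : Fin m → Fin (suc m)) where
  open Vertices m r

  sibling : Fin m → Fin m → Bool
  sibling x y = eqF (q y) (q x)

  sibling-isEqR : IsEqR sibling
  sibling-isEqR = record
    { rfl = λ x → eqF-refl (q x)
    ; sy = λ x y e → trans (eqF-sym (q x) (q y)) e
    ; tr = λ x y z e1 e2 → subst (λ w → eqF (q z) w ≡ true) (eqF-true e1) e2 }

  open IsEqR sibling-isEqR
  open Leaders sibling sibling-isEqR

  hasChildIn : (Fin m → Bool) → Fin m → Bool
  hasChildIn U y = any (λ z → U z ∧ eqF (q z) (ι y))

  prunable : (Fin m → Bool) → Fin m → Bool
  prunable U x = U x ∧ not (any (λ y → sibling x y ∧ hasChildIn U y))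

  output : Maybe (Fin m) → V
  output (just x) = q x
  output nothing = r

  prune : Maybe (Fin m) → (Fin m → Bool) → Fin m → Bool
  prune (just x) U y = U y ∧ not (sibling x y)
  prune nothing U = U

  encode : ∀ k → (Fin m → Bool) → Vec V k
  encode zero U = []
  encode (suc k) U = output (first (prunable U)) ∷ encode k (prune (first (prunable U)) U)

  encode-step : ∀ k U x → first (prunable U) ≡ just x → encode (suc k) U ≡ q x ∷ encode k (prune (just x) U)
  encode-step k U x e = cong (λ mx → output mx ∷ encode k (prune mx U)) e

  record EncInv (U : Fin m → Bool) (k : ℕ) : Set where
    field
      blockwise : ∀ y z → sibling y z ≡ true → U y ≡ U z
      blocks-left : count (λ y → U y ∧ isLeader y) ≡ k
      parent-closed : ∀ z w → U z ≡ true → q z ≡ ι w → U w ≡ true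

  prunable-U : ∀ {U x} → prunable U x ≡ true → U x ≡ true
  prunable-U e = proj₁ (∧-true e)

  prunable-childless : ∀ {U x} → prunable U x ≡ true → ∀ y z → sibling x y ≡ true → U z ≡ true → q z ≡ ι y → ⊥
  prunable-childless {U} {x} e y z sxy uz qz =
    true≢false (any-intro {P = λ y → sibling x y ∧ hasChildIn U y}
                 (∧-intro sxy (any-intro {P = λ z → U z ∧ eqF (q z) (ι y)}
                   (∧-intro uz (subst (λ w → eqF w (ι y) ≡ true) (sym qz) (eqF-refl (ι y)))))))
               (not-true (proj₂ (∧-true e)))

  encInv-empty : ∀ {U} → EncInv U 0 → ∀ y → U y ≡ false
  encInv-empty {U} inv y with U y in e
  ... | false = refl
  ... | true = ⊥-elim (<-irrefl refl (≤-trans (count-pos {P = λ y → U y ∧ isLeader y} {c = leader y}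
          (∧-intro (trans (sym (EncInv.blockwise inv y (leader y) (leader-R y))) e) (isLeader-leader y)))
          (≤-reflexive (EncInv.blocks-left inv))))

  encInv-step : ∀ {U k} x → first (prunable U) ≡ just x → EncInv U (suc k) → EncInv (prune (just x) U) k
  encInv-step {U} {k} x ex inv = record
    { blockwise = λ a b sab → cong₂ (λ u w → u ∧ not w) (blockwise a b sab)
                                     (cong (λ w → eqF w (q x)) (sym (eqF-true {a = q b} {b = q a} sab)))
    ; blocks-left = suc-injective (trans (sym (leaders-remove-block U ux blockwise)) blocks-left)
    ; parent-closed = closed }
    where
      open EncInv inv
      px = first-sound ex
      ux = prunable-U px
      closed : ∀ z w → U z ∧ not (sibling x z) ≡ true → q z ≡ ι w → U w ∧ not (sibling x w) ≡ true
      closed z w e qz with sibling x w in e2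
      ... | true = ⊥-elim (prunable-childless px w z e2 (proj₁ (∧-true e)) qz)
      ... | false = trans (∧-identityʳ _) (parent-closed z w (proj₁ (∧-true e)) qz)

  siblings-iterate-alike : ∀ {y z} → q y ≡ q z → ∀ j → iter (extend q) (suc j) (ι y) ≡ iter (extend q) (suc j) (ι z)
  siblings-iterate-alike {y} {z} qyz j = cong (iter (extend q) j) (trans (extend-ι q y) (trans qyz (sym (extend-ι q z))))

  -- in a tree, a nonempty U always contains a prunable vertex: otherwise
  -- following "a child of a sibling" inside U forever would produce
  -- vertices whose m+1-st ancestor is not the root
  prunable-exists : ∀ {U k} → (∀ v → iter (extend q) (suc m) v ≡ r) → EncInv U (suc k)
                  → Σ (Fin m) λ x → first (prunable U) ≡ just x
  prunable-exists {U} {k} tree inv with first (prunable U) in e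
  ... | just x = x , refl
  ... | nothing = ⊥-elim (never-root (deep (suc m)))
    where
      P = extend q
      stuck : ∀ x → U x ≡ true → Σ (Fin m) λ y → Σ (Fin m) λ z → q y ≡ q x × U z ≡ true × q z ≡ ι y
      stuck x ux with any (λ y → sibling x y ∧ hasChildIn U y) in ea
      stuck x ux | false = ⊥-elim (true≢false (∧-intro ux (cong not ea)) (first-none e x))
      stuck x ux | true with any-witness ea
      ... | y , sy with ∧-true sy
      ... | sxy , child with any-witness child
      ... | z , uz with ∧-true uz
      ... | uz' , qz = y , z , eqF-true sxy , uz' , eqF-true qz
      start = count-witness {P = λ y → U y ∧ isLeader y} (EncInv.blocks-left inv)
      deep : ∀ j → Σ (Fin m) λ z → U z ≡ true × Σ (Fin m) λ w → iter P j (ι z) ≡ ι w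
      deep zero = proj₁ start , proj₁ (∧-true (proj₂ start)) , proj₁ start , refl
      deep (suc j) with deep j
      ... | z , uz , w , ez with stuck z uz
      ... | y , z' , qyz , uz' , qz' = z' , uz' , climb j ez
        where
          step : ∀ j → iter P (suc j) (ι z') ≡ iter P j (ι y)
          step j = cong (iter P j) (trans (extend-ι q z') qz')
          climb : ∀ j → iter P j (ι z) ≡ ι w → Σ (Fin m) λ w' → iter P (suc j) (ι z') ≡ ι w'
          climb zero _ = y , step zero
          climb (suc j) ez = w , trans (step (suc j)) (trans (siblings-iterate-alike qyz j) ez)
      never-root : (Σ (Fin m) λ z → U z ≡ true × Σ (Fin m) λ w → iter P (suc m) (ι z) ≡ ι w) → ⊥
      never-root (z , _ , w , ez) = ι≢r w (trans (sym ez) (tree (ι z)))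

  module OfTree (tree : ∀ v → iter (extend q) (suc m) v ≡ r) where

    encode-parents⁻ : ∀ {U} k → EncInv U k → ∀ v → memV v (encode k U) ≡ true → Σ (Fin m) λ z → U z ≡ true × q z ≡ v
    encode-parents⁻ zero inv v ()
    encode-parents⁻ {U} (suc k) inv v mv with prunable-exists tree inv
    ... | x , e with ∨-case (subst (λ s → memV v s ≡ true) (encode-step k U x e) mv)
    ... | inj₁ h = x , prunable-U (first-sound e) , sym (eqF-true h)
    ... | inj₂ h with encode-parents⁻ k (encInv-step x e inv) v h
    ... | z , uz , qz = z , proj₁ (∧-true uz) , qz

    encode-parents⁺ : ∀ {U} k → EncInv U k → ∀ z → U z ≡ true → memV (q z) (encode k U) ≡ true
    encode-parents⁺ zero inv z uz = ⊥-elim (true≢false uz (encInv-empty inv z))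
    encode-parents⁺ {U} (suc k) inv z uz with prunable-exists tree inv
    ... | x , e = subst (λ s → memV (q z) s ≡ true) (sym (encode-step k U x e)) head-or-rest
      where
        head-or-rest : memV (q z) (q x ∷ encode k (prune (just x) U)) ≡ true
        head-or-rest with sibling x z in e1
        ... | true = refl
        ... | false = encode-parents⁺ k (encInv-step x e inv) z
                        (subst (λ b → U z ∧ not b ≡ true) (sym e1) (trans (∧-identityʳ _) uz))

    -- each parent is output once: after its block is pruned it has no child left in U
    encode-unique : ∀ {U} k → EncInv U k → Unique (toList (encode k U))
    encode-unique zero inv = []
    encode-unique {U} (suc k) inv with prunable-exists tree inv
    ... | x , e = subst (λ s → Unique (toList s)) (sym (encode-step k U x e))
        (All.tabulate (λ {w} w∈ eqw → not-later (subst (λ t → memV t (encode k (prune (just x) U)) ≡ true)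
                                                        (sym eqw) (memV-complete w∈)))
         ∷ encode-unique k (encInv-step x e inv))
      where
        not-later : memV (q x) (encode k (prune (just x) U)) ≡ true → ⊥
        not-later h with encode-parents⁻ k (encInv-step x e inv) (q x) h
        ... | z , uz , qz = true≢false (proj₂ (∧-true uz)) (cong not (subst (λ w → eqF w (q x) ≡ true) (sym qz) (eqF-refl (q x))))

    -- the last pruned block consists of children of the root
    encode-last : ∀ {U} k → EncInv U k → LastIs (encode k U) r
    encode-last zero inv = tt
    encode-last {U} (suc k) inv with prunable-exists tree inv
    ... | x , e = subst (λ s → LastIs s r) (sym (encode-step k U x e)) (go k (encInv-step x e inv))
      where
        px = first-sound e
        go : ∀ k → EncInv (prune (just x) U) k → LastIs (q x ∷ encode k (prune (just x) U)) r
        go (suc k') inv' = encode-last (suc k') inv'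
        go zero inv' with ι-or-r (q x)
        ... | inj₁ h = h
        ... | inj₂ (w , h) = ⊥-elim (prunable-childless px w x sxw (prunable-U px) h)
          where
            uw : U w ≡ true
            uw = EncInv.parent-closed inv x w (prunable-U px) h
            sxw : sibling x w ≡ true
            sxw with sibling x w in e3
            ... | true = refl
            ... | false = ⊥-elim (true≢false (trans (∧-identityʳ _) uw)
                                   (trans (cong (λ b → U w ∧ not b) (sym e3)) (encInv-empty inv' w)))

is-nothing-true : ∀ {A : Set} {a : Maybe A} → is-nothing a ≡ true → a ≡ nothing
is-nothing-true {a = nothing} _ = refl

module Decoding (m : ℕ) (r : Fin (suc m)) (R : Fin m → Fin m → Bool) where
  open Vertices m r

  Assignment = Fin m → Maybe V

  assignable : ∀ {k} → Assignment → Vec V k → Fin m → Bool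
  assignable A s x = is-nothing (A x) ∧ not (any (λ y → R x y ∧ memV (ι y) s))

  assign : Maybe (Fin m) → V → Assignment → Assignment
  assign (just x) v A y = if R x y then just v else A y
  assign nothing v A = A

  decode : ∀ {k} → Vec V k → Assignment → Assignment
  decode [] A = A
  decode (v ∷ s) A = decode s (assign (first (assignable A (v ∷ s))) v A)

  assign-hit : ∀ {x y v A} → R x y ≡ true → assign (just x) v A y ≡ just v
  assign-hit {x} {y} {v} {A} e = cong (λ b → if b then just v else A y) e

  assign-miss : ∀ {x y v A} → R x y ≡ false → assign (just x) v A y ≡ A y
  assign-miss {x} {y} {v} {A} e = cong (λ b → if b then just v else A y) e

  assignable-unassigned : ∀ {k} {A : Assignment} {s : Vec V k} {x} → assignable A s x ≡ true → A x ≡ nothing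
  assignable-unassigned e = is-nothing-true (proj₁ (∧-true e))

  assignable-not-upcoming : ∀ {k} {A : Assignment} {s : Vec V k} {x}
    → assignable A s x ≡ true → ∀ y → R x y ≡ true → memV (ι y) s ≡ false
  assignable-not-upcoming {A = A} {s} {x} e y rxy with memV (ι y) s in e2
  ... | false = refl
  ... | true = ⊥-elim (true≢false (any-intro {P = λ y → R x y ∧ memV (ι y) s} (∧-intro rxy e2))
                                  (not-true (proj₂ (∧-true e))))

  module Correctness (E : IsEqR R) where
    open IsEqR E
    open Leaders R E

    record DecInv {k} (A : Assignment) (s : Vec V k) : Set where
      field
        blockwise : ∀ x y → R x y ≡ true → A x ≡ A y
        blocks-left : count (λ y → is-nothing (A y) ∧ isLeader y) ≡ k
        upcoming-unassigned : ∀ w → memV (ι w) s ≡ true → A w ≡ nothing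
        used-not-upcoming : ∀ y v → A y ≡ just v → memV v s ≡ false
        same-parent-related : ∀ y z v → A y ≡ just v → A z ≡ just v → R y z ≡ true
        unique : Unique (toList s)
        last : LastIs s r

    -- pigeonhole: the |s| unassigned blocks cannot all meet the fewer than
    -- |s| non-root vertices of s, so an assignable vertex exists
    assignable-exists : ∀ {k} {A : Assignment} (v : V) (s : Vec V k) → DecInv A (v ∷ s)
                      → Σ (Fin m) λ x → first (assignable A (v ∷ s)) ≡ just x
    assignable-exists {k} {A} v s inv with first (assignable A (v ∷ s)) in e
    ... | just x = x , refl
    ... | nothing = ⊥-elim (<-irrefl refl (≤-trans (s≤s blocks≤upcoming)
          (≤-trans (nonroot-count (v ∷ s) (DecInv.unique inv) (lastIs-∈ v s (DecInv.last inv)))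
                   (≤-reflexive (sym (DecInv.blocks-left inv))))))
      where
        open DecInv inv
        Pending = λ y → is-nothing (A y) ∧ isLeader y
        Upcoming = λ y → memV (ι y) (v ∷ s)
        meets : Fin m → Fin m → Bool
        meets x y = R x y ∧ Upcoming y
        witness : Fin m → Fin m
        witness x = fromMaybe x (first (meets x))
        witness-meets : ∀ x → Pending x ≡ true → meets x (witness x) ≡ true
        witness-meets x px with first (meets x) in e3
        ... | just c = first-sound e3
        ... | nothing = ⊥-elim (true≢false
               (∧-intro (proj₁ (∧-true px)) (cong not (cong (maybe′ (λ _ → true) false) e3))) (first-none e x))
        blocks≤upcoming : count Pending ≤ count Upcoming
        blocks≤upcoming = count-injection witness (λ x px → proj₂ (∧-true (witness-meets x px)))
          (λ x y px py e5 → isLeader-injective (proj₂ (∧-true px)) (proj₂ (∧-true py))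
             (tr x (witness x) y (proj₁ (∧-true (witness-meets x px)))
                 (subst (λ z → R z y ≡ true) (sym e5) (sy y (witness y) (proj₁ (∧-true (witness-meets y py)))))))

    module Step {k} {A : Assignment} (v : V) (s : Vec V k) (x : Fin m)
                (ex : first (assignable A (v ∷ s)) ≡ just x) (inv : DecInv A (v ∷ s)) where
      open DecInv inv
      A' = assign (just x) v A

      x-unassigned : A x ≡ nothing
      x-unassigned = assignable-unassigned {A = A} {s = v ∷ s} (first-sound ex)

      unfold : decode (v ∷ s) A ≡ decode s A'
      unfold = cong (λ mx → decode s (assign mx v A)) ex

      keep : ∀ y u → A y ≡ just u → A' y ≡ just u
      keep y u ay with R x y in e1
      ... | false = ay
      ... | true with () ← trans (sym x-unassigned) (trans (blockwise x y e1) ay)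

      v-not-later : memV v s ≡ false
      v-not-later with memV v s in e
      ... | false = refl
      ... | true with unique
      ... | v∉s ∷ _ = ⊥-elim (All.lookup v∉s (memV-sound e) refl)

      blockwise' : ∀ a b → R a b ≡ true → A' a ≡ A' b
      blockwise' a b rab with R x a in e1 | R x b in e2
      ... | true | true = refl
      ... | false | false = blockwise a b rab
      ... | true | false = ⊥-elim (true≢false (tr x a b e1 rab) e2)
      ... | false | true = ⊥-elim (true≢false (tr x b a e2 (sy a b rab)) e1)

      unassigned' : ∀ y → is-nothing (A' y) ≡ is-nothing (A y) ∧ not (R x y)
      unassigned' y with R x y
      ... | true = sym (∧-zeroʳ _)
      ... | false = sym (∧-identityʳ _)

      blocks-left' : count (λ y → is-nothing (A' y) ∧ isLeader y) ≡ k
      blocks-left' = trans (count-cong (λ y → cong (_∧ isLeader y) (unassigned' y)))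
        (suc-injective (trans (sym (leaders-remove-block (λ y → is-nothing (A y)) (cong is-nothing x-unassigned)
                                                         (λ y z ryz → cong is-nothing (blockwise y z ryz))))
                              blocks-left))

      upcoming' : ∀ w → memV (ι w) s ≡ true → A' w ≡ nothing
      upcoming' w e with R x w in e1
      ... | true = ⊥-elim (true≢false (memV-there {s = s} v e)
                                      (assignable-not-upcoming {A = A} {s = v ∷ s} (first-sound ex) w e1))
      ... | false = upcoming-unassigned w (memV-there {s = s} v e)

      used' : ∀ y u → A' y ≡ just u → memV u s ≡ false
      used' y u e with R x y
      used' y u refl | true = v-not-later
      ... | false with used-not-upcoming y u e
      ... | e2 with eqF u v | memV u s
      ... | false | false = refl

      same-parent' : ∀ a b u → A' a ≡ just u → A' b ≡ just u → R a b ≡ true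
      same-parent' a b u ea eb with R x a in e1 | R x b in e2
      ... | true | true = tr a x b (sy x a e1) e2
      ... | false | false = same-parent-related a b u ea eb
      same-parent' a b u refl eb | true | false = ⊥-elim (true≢false (memV-head v s) (used-not-upcoming b v eb))
      same-parent' a b u ea refl | false | true = ⊥-elim (true≢false (memV-head v s) (used-not-upcoming a v ea))

      inv' : DecInv A' s
      inv' = record
        { blockwise = blockwise' ; blocks-left = blocks-left' ; upcoming-unassigned = upcoming'
        ; used-not-upcoming = used' ; same-parent-related = same-parent'
        ; unique = tail-unique unique ; last = lastIs-tail v s last }
        where
          tail-unique : Unique (v ∷ toList s) → Unique (toList s)
          tail-unique (_ ∷ u) = u

    decode-inv : ∀ {k} {A : Assignment} (s : Vec V k) → DecInv A s → DecInv (decode s A) []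
    decode-inv [] inv = inv
    decode-inv (v ∷ s) inv with assignable-exists v s inv
    ... | x , e = subst (λ F → DecInv F []) (sym unfold) (decode-inv s inv')
      where open Step v s x e inv

    decode-total : ∀ {A : Assignment} → DecInv A [] → ∀ y → Σ V λ v → A y ≡ just v
    decode-total {A} inv y with A y in e
    ... | just v = v , refl
    ... | nothing = ⊥-elim (<-irrefl refl (≤-trans
          (count-pos {P = λ y → is-nothing (A y) ∧ isLeader y} {c = leader y}
            (∧-intro (cong is-nothing (trans (sym (DecInv.blockwise inv y (leader y) (leader-R y))) e)) (isLeader-leader y)))
          (≤-reflexive (DecInv.blocks-left inv))))

    decode-keeps : ∀ {k} {A : Assignment} (s : Vec V k) → DecInv A s → ∀ y u → A y ≡ just u → decode s A y ≡ just u
    decode-keeps [] inv y u ay = ay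
    decode-keeps (v ∷ s) inv y u ay with assignable-exists v s inv
    ... | x , e = trans (cong-app unfold y) (decode-keeps s inv' y u (keep y u ay))
      where open Step v s x e inv

    decode-step-parent : ∀ {k} {A : Assignment} (v : V) (s : Vec V k) x (e : first (assignable A (v ∷ s)) ≡ just x)
      (inv : DecInv A (v ∷ s)) → ∀ y → R x y ≡ true → decode (v ∷ s) A y ≡ just v
    decode-step-parent {A = A} v s x e inv y rxy =
      trans (cong-app unfold y) (decode-keeps s inv' y v (assign-hit {A = A} rxy))
      where open Step v s x e inv

    decode-parent-in-seq : ∀ {k} {A : Assignment} (s : Vec V k) → DecInv A s
      → ∀ y u → A y ≡ nothing → decode s A y ≡ just u → memV u s ≡ true
    decode-parent-in-seq [] inv y u ay e with () ← trans (sym ay) e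
    decode-parent-in-seq {A = A} (v ∷ s) inv y u ay ed with assignable-exists v s inv
    ... | x , e with R x y in e1
    ... | true = subst (λ w → memV w (v ∷ s) ≡ true)
                   (MaybeP.just-injective (trans (sym (decode-step-parent v s x e inv y e1)) ed)) (memV-head v s)
    ... | false = memV-there {s = s} v (decode-parent-in-seq s inv' y u (trans (assign-miss {A = A} e1) ay)
                    (trans (sym (cong-app unfold y)) ed))
      where open Step v s x e inv

    decode-seq-is-parent : ∀ {k} {A : Assignment} (s : Vec V k) → DecInv A s
      → ∀ u → memV u s ≡ true → Σ (Fin m) λ y → A y ≡ nothing × decode s A y ≡ just u
    decode-seq-is-parent [] inv u ()
    decode-seq-is-parent {A = A} (v ∷ s) inv u mu with assignable-exists v s inv
    ... | x , e with eqF u v in e1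
    ... | true = x , x-unassigned ,
                 subst (λ w → decode (v ∷ s) A x ≡ just w) (sym (eqF-true e1)) (decode-step-parent v s x e inv x (rfl x))
      where open Step v s x e inv
    ... | false with decode-seq-is-parent s inv' u mu
      where open Step v s x e inv
    ... | y , ay , dy = y , unassigned-before , trans (cong-app unfold y) dy
      where
        open Step v s x e inv
        unassigned-before : A y ≡ nothing
        unassigned-before with R x y
        ... | false = ay

    -- the decoded parent map Q is a tree: a vertex unassigned before
    -- reading s reaches the root within |s| steps, because its parent is
    -- read later in s than every vertex of its block
    decode-reaches-root : ∀ {k} {A : Assignment} (s : Vec V k) (Q : Fin m → V) → DecInv A s
      → (∀ y u → decode s A y ≡ just u → Q y ≡ u)
      → ∀ z → A z ≡ nothing → iter (extend Q) k (ι z) ≡ r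
    decode-reaches-root [] Q inv H z az with decode-total inv z
    ... | v , e with () ← trans (sym az) e
    decode-reaches-root {suc k} {A} (v ∷ s) Q inv H z az with assignable-exists v s inv
    ... | x , e with R x z in e1
    ... | false = begin
      iter (extend Q) (suc k) (ι z)   ≡⟨ iter-suc (extend Q) k (ι z) ⟩
      extend Q (iter (extend Q) k (ι z)) ≡⟨ cong (extend Q) (decode-reaches-root s Q inv' H' z (trans (assign-miss {A = A} e1) az)) ⟩
      extend Q r                      ≡⟨ extend-r Q ⟩
      r                               ∎
      where
        open ≡-Reasoning
        open Step v s x e inv
        H' : ∀ y u → decode s A' y ≡ just u → Q y ≡ u
        H' y u d = H y u (trans (cong-app unfold y) d)
    ... | true = begin
      iter (extend Q) k (extend Q (ι z)) ≡⟨ cong (iter (extend Q) k) (extend-ι Q z) ⟩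
      iter (extend Q) k (Q z)            ≡⟨ cong (iter (extend Q) k) (H z v (decode-step-parent v s x e inv z e1)) ⟩
      iter (extend Q) k v                ≡⟨ from-parent (ι-or-r v) ⟩
      r                                  ∎
      where
        open ≡-Reasoning
        open Step v s x e inv
        H' : ∀ y u → decode s A' y ≡ just u → Q y ≡ u
        H' y u d = H y u (trans (cong-app unfold y) d)
        from-parent : (v ≡ r ⊎ Σ (Fin m) λ w → v ≡ ι w) → iter (extend Q) k v ≡ r
        from-parent (inj₁ refl) = iter-extend-r Q k
        from-parent (inj₂ (w , refl)) = decode-reaches-root s Q inv' H' w (trans (assign-miss {A = A} rxw) aw)
          where
            aw : A w ≡ nothing
            aw = DecInv.upcoming-unassigned inv w (memV-head v s)
            rxw : R x w ≡ false
            rxw with R x w in e2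
            ... | false = refl
            ... | true = ⊥-elim (true≢false (memV-head (ι w) s)
                                            (assignable-not-upcoming {A = A} {s = ι w ∷ s} (first-sound e) w e2))

-- Along the way the decoder makes exactly the choices of
-- the encoder: "the block of x has no vertex occurring in the rest of
-- the sequence" is the same test as "no sibling of x has a child in U".

module DecodeEncode (m : ℕ) (r : Fin (suc m)) (q : Fin m → Fin (suc m))
                    (tree : ∀ v → iter (Vertices.extend m r q) (suc m) v ≡ r)
                    (R : Fin m → Fin m → Bool) (R-sibling : ∀ x y → R x y ≡ Encoding.sibling m r q x y) where
  open Vertices m r
  open Encoding m r q
  open OfTree tree
  open Decoding m r R

  memV-encode : ∀ {U} k → EncInv U k → ∀ y → memV (ι y) (encode k U) ≡ hasChildIn U y
  memV-encode {U} k inv y = bool-iff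
    (λ h → let (z , uz , qz) = encode-parents⁻ k inv (ι y) h
           in any-intro {P = λ w → U w ∧ eqF (q w) (ι y)} (∧-intro uz (subst (λ t → eqF t (ι y) ≡ true) (sym qz) (eqF-refl (ι y)))))
    (λ h → let (z , hz) = any-witness {P = λ w → U w ∧ eqF (q w) (ι y)} h ; (uz , qz) = ∧-true hz
           in subst (λ t → memV t (encode k U) ≡ true) (eqF-true qz) (encode-parents⁺ k inv z uz))

  known : (Fin m → Bool) → Assignment
  known U y = if U y then nothing else just (q y)

  decode-encode : ∀ k U (A : Assignment) → EncInv U k → (∀ y → A y ≡ known U y)
                → ∀ y → decode (encode k U) A y ≡ just (q y)
  decode-encode zero U A inv h y = trans (h y) (cong (λ b → if b then nothing else just (q y)) (encInv-empty inv y))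
  decode-encode (suc k) U A inv h y with prunable-exists tree inv
  ... | x , e = trans (cong-app (cong₂ (λ mx my → decode (encode k (prune mx U)) (assign my (output mx) A)) e same-choice) y)
                      (decode-encode k (prune (just x) U) (assign (just x) (q x) A) (encInv-step x e inv) known' y)
    where
      same-test : ∀ z → assignable A (encode (suc k) U) z ≡ prunable U z
      same-test z = cong₂ (λ a b → a ∧ not b) unassigned
                          (any-cong (λ y → cong₂ _∧_ (R-sibling z y) (memV-encode (suc k) inv y)))
        where
          unassigned : is-nothing (A z) ≡ U z
          unassigned rewrite h z with U z
          ... | true = refl
          ... | false = refl
      same-choice : first (assignable A (encode (suc k) U)) ≡ just x
      same-choice = trans (first-cong same-test) e
      known' : ∀ y → assign (just x) (q x) A y ≡ known (prune (just x) U) y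
      known' y rewrite R-sibling x y with sibling x y in e1
      ... | true = trans (cong just (sym (eqF-true e1))) (sym (cong (λ b → if b then nothing else just (q y)) (∧-zeroʳ (U y))))
      ... | false = trans (h y) (sym (cong (λ b → if b then nothing else just (q y)) (∧-identityʳ (U y))))

module EncodeDecode (m : ℕ) (r : Fin (suc m)) (R : Fin m → Fin m → Bool) (E : IsEqR R) (Q : Fin m → Fin (suc m))
                    (R-sibling : ∀ x y → R x y ≡ Encoding.sibling m r Q x y) where
  open Vertices m r
  open Decoding m r R
  open Correctness E
  open Encoding m r Q using (sibling; prunable; encode; prune; encode-step)

  encode-decode : ∀ {k} (s : Vec V k) (A : Assignment) (U : Fin m → Bool) → DecInv A s
    → (∀ y u → decode s A y ≡ just u → Q y ≡ u) → (∀ y → U y ≡ is-nothing (A y)) → encode k U ≡ s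
  encode-decode [] A U inv H hU = refl
  encode-decode {suc k} (v ∷ s) A U inv H hU with assignable-exists v s inv
  ... | x , e = trans (encode-step k U x same-choice) (cong₂ _∷_ Qx (encode-decode s A' (prune (just x) U) inv' H' hU'))
    where
      open Step v s x e inv
      H' : ∀ y u → decode s A' y ≡ just u → Q y ≡ u
      H' y u d = H y u (trans (cong-app unfold y) d)
      Qx : Q x ≡ v
      Qx = H x v (decode-step-parent v s x e inv x (IsEqR.rfl E x))
      hU' : ∀ y → (U y ∧ not (sibling x y)) ≡ is-nothing (A' y)
      hU' y rewrite sym (R-sibling x y) with R x y
      ... | true = ∧-zeroʳ (U y)
      ... | false = trans (∧-identityʳ (U y)) (hU y)
      upcoming-is-parent : ∀ y → memV (ι y) (v ∷ s) ≡ any (λ w → U w ∧ eqF (Q w) (ι y))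
      upcoming-is-parent y = bool-iff
        (λ h → let (w , aw , dw) = decode-seq-is-parent (v ∷ s) inv (ι y) h in
           any-intro {P = λ w → U w ∧ eqF (Q w) (ι y)} (∧-intro (trans (hU w) (cong is-nothing aw))
              (subst (λ t → eqF t (ι y) ≡ true) (sym (H w (ι y) dw)) (eqF-refl (ι y)))))
        (λ h → let (w , hw) = any-witness {P = λ w → U w ∧ eqF (Q w) (ι y)} h
                   (uw , qw) = ∧-true hw
                   (u , du) = decode-total (decode-inv (v ∷ s) inv) w
               in decode-parent-in-seq (v ∷ s) inv w (ι y) (is-nothing-true (trans (sym (hU w)) uw))
                    (trans du (cong just (trans (sym (H w u du)) (eqF-true qw)))))
      same-test : ∀ z → prunable U z ≡ assignable A (v ∷ s) z
      same-test z = cong₂ (λ a b → a ∧ not b) (hU z)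
                          (any-cong (λ y → cong₂ _∧_ (sym (R-sibling z y)) (sym (upcoming-is-parent y))))
      same-choice : first (prunable U) ≡ just x
      same-choice = trans (first-cong same-test) e

vec-ext : ∀ {A : Set} {k} {u w : Vec A k} → (∀ i → lookup u i ≡ lookup w i) → u ≡ w
vec-ext {u = u} {w} h = trans (sym (tabulate∘lookup u)) (trans (tabulate-cong h) (tabulate∘lookup w))

∈-toList⇒lookup : ∀ {A : Set} {k} {B : A} (M : Vec A k) → B ∈ toList M → Σ (Fin k) λ x → B ≡ lookup M x
∈-toList⇒lookup M B∈ = let p = VecMem.∈-toList⁻ B∈ in VecAny.index p , VecAnyP.lookup-index p

lookup∈toList : ∀ {A : Set} {k} (M : Vec A k) x → lookup M x ∈ toList M
lookup∈toList M x = VecMem.∈-toList⁺ (VecMem.∈-lookup x M)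

∣∣-pos : ∀ {k} (p : Subset k) x → lookup p x ≡ true → 1 ≤ ∣ p ∣
∣∣-pos (true ∷ p) zero e = s≤s z≤n
∣∣-pos (true ∷ p) (suc x) e = s≤s z≤n
∣∣-pos (false ∷ p) (suc x) e = ∣∣-pos p x e

∣tabulate∣ : ∀ {k} (b : Fin k → Bool) → ∣ tabulate b ∣ ≡ count b
∣tabulate∣ b = sym (go b (λ x → x))
  where
    go : ∀ {k} {j} (b : Fin j → Bool) (f : Fin k → Fin j)
       → length (filter (λ x → T? (b x)) (List.tabulate f)) ≡ ∣ tabulate (λ x → b (f x)) ∣
    go {zero} b f = refl
    go {suc k} b f with b (f zero)
    ... | true = cong suc (go b (λ x → f (suc x)))
    ... | false = go b (λ x → f (suc x))

sum1to : ℕ → (ℕ → ℕ) → ℕ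
sum1to zero g = 0
sum1to (suc N) g = g (suc N) + sum1to N g

sum1to-+ : ∀ N g h → sum1to N (λ i → g i + h i) ≡ sum1to N g + sum1to N h
sum1to-+ zero g h = refl
sum1to-+ (suc N) g h = trans (cong (g (suc N) + h (suc N) +_) (sum1to-+ N g h))
                             (+-interchange (g (suc N)) (h (suc N)) (sum1to N g) (sum1to N h))

sum1to-cong : ∀ N {g h} → (∀ i → 1 ≤ i → i ≤ N → g i ≡ h i) → sum1to N g ≡ sum1to N h
sum1to-cong zero h = refl
sum1to-cong (suc N) h = cong₂ _+_ (h (suc N) (s≤s z≤n) ≤-refl) (sum1to-cong N (λ i a b → h i a (≤-trans b (n≤1+n N))))

sum1to-zero : ∀ N → sum1to N (λ _ → 0) ≡ 0
sum1to-zero zero = refl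
sum1to-zero (suc N) = sum1to-zero N

fromDec : ∀ {P : Set} → Dec P → ℕ
fromDec (yes _) = 1
fromDec (no _) = 0

length-filter-∷ : ∀ {A : Set} {P : A → Set} (P? : ∀ y → Dec (P y)) x xs
                → length (filter P? (x ∷ xs)) ≡ fromDec (P? x) + length (filter P? xs)
length-filter-∷ P? x xs with P? x
... | yes _ = refl
... | no _ = refl

indicator : ℕ → ℕ → ℕ
indicator a i = fromDec (a ℕ.≟ i)

sum1to-indicator-out : ∀ N a → N < a → sum1to N (indicator a) ≡ 0
sum1to-indicator-out zero a _ = refl
sum1to-indicator-out (suc N) a lt with a ℕ.≟ suc N
... | yes refl = ⊥-elim (<-irrefl refl lt)
... | no _ = sum1to-indicator-out N a (≤-trans (n≤1+n _) lt)

sum1to-indicator-in : ∀ N a → 1 ≤ a → a ≤ N → sum1to N (indicator a) ≡ 1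
sum1to-indicator-in zero a p q with () ← ≤-trans p q
sum1to-indicator-in (suc N) a p q with a ℕ.≟ suc N
... | yes refl = cong suc (sum1to-indicator-out N (suc N) ≤-refl)
... | no ne = sum1to-indicator-in N a p (≤-pred (≤∧≢⇒< q ne))

multOf : ∀ {A : Set} → (A → ℕ) → List A → ℕ → ℕ
multOf f xs i = length (filter (λ y → f y ℕ.≟ i) xs)

multOf-∷ : ∀ {A : Set} (f : A → ℕ) x xs i → multOf f (x ∷ xs) i ≡ indicator (f x) i + multOf f xs i
multOf-∷ f x xs i = length-filter-∷ (λ y → f y ℕ.≟ i) x xs

sum-multOf : ∀ {A : Set} N (f : A → ℕ) (xs : List A) → (∀ {x} → x ∈ xs → 1 ≤ f x × f x ≤ N)
           → sum1to N (multOf f xs) ≡ length xs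
sum-multOf N f [] h = sum1to-zero N
sum-multOf N f (x ∷ xs) h = begin
  sum1to N (multOf f (x ∷ xs))                             ≡⟨ sum1to-cong N (λ i _ _ → multOf-∷ f x xs i) ⟩
  sum1to N (λ i → indicator (f x) i + multOf f xs i)        ≡⟨ sum1to-+ N (indicator (f x)) (multOf f xs) ⟩
  sum1to N (indicator (f x)) + sum1to N (multOf f xs)      ≡⟨ cong₂ _+_ (sum1to-indicator-in N (f x) (proj₁ (h (here refl))) (proj₂ (h (here refl))))
                                                                        (sum-multOf N f xs (λ x∈ → h (there x∈))) ⟩
  suc (length xs)                                          ∎
  where open ≡-Reasoning

∈⇒≤sum : ∀ {x} (xs : List ℕ) → x ∈ xs → x ≤ sum xs
∈⇒≤sum (x ∷ xs) (here refl) = m≤m+n x (sum xs)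
∈⇒≤sum (y ∷ xs) (there x∈) = ≤-trans (∈⇒≤sum xs x∈) (m≤n+m (sum xs) y)

length-by-mult : ∀ {m} (λ' : List ℕ) → IsPartitionOf λ' m → sum1to m (λ i → mult i λ') ≡ length λ'
length-by-mult λ' (positive , _ , total) =
  sum-multOf _ (λ x → x) λ' (λ x∈ → All.lookup positive x∈ , subst (_ ≤_) total (∈⇒≤sum λ' x∈))

siblingMatrix : ∀ {m k} → (Fin m → Fin k) → Vec (Vec Bool m) m
siblingMatrix q = tabulate (λ x → tabulate (λ y → eqF (q y) (q x)))

siblingMatrix-entry : ∀ {m k} (q : Fin m → Fin k) x y → lookup (lookup (siblingMatrix q) x) y ≡ eqF (q y) (q x)
siblingMatrix-entry q x y = trans (cong (λ w → lookup w y) (lookup∘tabulate (λ x → tabulate (λ y → eqF (q y) (q x))) x))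
                                  (lookup∘tabulate (λ y → eqF (q y) (q x)) y)

module BlockCount {m} (R : Fin m → Fin m → Bool) (E : IsEqR R) (M : Vec (Vec Bool m) m)
                  (RM : ∀ x y → lookup (lookup M x) y ≡ R x y) where
  open IsEqR E
  open Leaders R E

  row-leader : ∀ x → lookup M x ≡ lookup M (leader x)
  row-leader x = vec-ext (λ z → trans (RM x z) (trans (R-row (leader-R x) z) (sym (RM (leader x) z))))

  blocks≡leader-rows : length (blocks M) ≡ count isLeader
  blocks≡leader-rows = trans
    (unique-≈⇒length-≡ (≡-dec Bool._≟_) (DecUniqueP.deduplicate-! (≡-dec Bool._≟_) (toList M))
      (map-unique (lookup M) (satisfying-unique isLeader) (λ {a} {b} a∈ b∈ e →
         isLeader-injective (∈-satisfying⁻ a∈) (∈-satisfying⁻ b∈)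
           (trans (sym (RM a b)) (trans (cong (λ w → lookup w b) e) (trans (RM b b) (rfl b))))))
      (λ {B} B∈ → let (x , e) = ∈-toList⇒lookup M (∈-deduplicate⁻ (≡-dec Bool._≟_) (toList M) B∈)
                  in subst (_∈ map (lookup M) (satisfying isLeader)) (sym (trans e (row-leader x)))
                           (∈-map⁺ (lookup M) (∈-satisfying⁺ (isLeader-leader x))))
      (λ {B} B∈ → let (x , _ , e) = ∈-map⁻ (lookup M) B∈
                  in subst (_∈ blocks M) (sym e) (∈-deduplicate⁺ (≡-dec Bool._≟_) (lookup∈toList M x))))
    (length-map (lookup M) (satisfying isLeader))

  block-size-bounds : ∀ {B} → B ∈ blocks M → 1 ≤ ∣ B ∣ × ∣ B ∣ ≤ m
  block-size-bounds {B} B∈ with ∈-toList⇒lookup M (∈-deduplicate⁻ (≡-dec Bool._≟_) (toList M) B∈)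
  ... | x , refl = ∣∣-pos (lookup M x) x (trans (RM x x) (rfl x)) , ∣p∣≤n (lookup M x)

  leaders-by-type : ∀ (λ' : List ℕ) → IsPartitionOf λ' m → (∀ i → 1 ≤ i → blockMult M i ≡ mult i λ')
                  → count isLeader ≡ length λ'
  leaders-by-type λ' partition type = begin
    count isLeader                      ≡⟨ blocks≡leader-rows ⟨
    length (blocks M)                   ≡⟨ sum-multOf m ∣_∣ (blocks M) block-size-bounds ⟨
    sum1to m (blockMult M)              ≡⟨ sum1to-cong m (λ i p _ → type i p) ⟩
    sum1to m (λ i → mult i λ')          ≡⟨ length-by-mult λ' partition ⟩
    length λ'                           ∎
    where open ≡-Reasoning

-- the sibling partition of a parent map has the indegree sequence as type:
-- its blocks are the children sets of the vertices of positive indegree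
module SiblingType (m : ℕ) (r : Fin (suc m)) (par : Vec (Fin (suc m)) (suc m)) where
  open Vertices m r

  q : Fin m → V
  q y = lookup par (ι y)

  children : V → Vec Bool m
  children v = tabulate (λ y → eqF (q y) v)

  indeg-count : ∀ v → indeg r par v ≡ count (λ y → eqF (q y) v)
  indeg-count v = trans
    (unique-≈⇒length-≡ _≟F_ (UniqueP.filter⁺ (isChild v) (UniqueP.allFin⁺ _))
      (map-unique ι (satisfying-unique b) (λ _ _ → punchIn-injective r _ _))
      (λ {u} u∈ → let (_ , (u≢r , pu)) = ∈-filter⁻ (isChild v) {xs = allFin (suc m)} u∈ in child⇒ι u u≢r pu)
      (λ {z} z∈ → let (w , w∈ , e) = ∈-map⁻ ι z∈
                  in subst (_∈ filter (isChild v) (allFin (suc m))) (sym e)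
                       (∈-filter⁺ (isChild v) (∈-allFin (ι w)) (ι≢r w , eqF-true (∈-satisfying⁻ {P = b} w∈)))))
    (length-map ι (satisfying b))
    where
      isChild = λ v u → ¬? (u ≟F r) ×-dec (lookup par u ≟F v)
      b = λ y → eqF (q y) v
      child⇒ι : ∀ u → u ≢ r → lookup par u ≡ v → u ∈ map ι (satisfying b)
      child⇒ι u u≢r pu with ι-or-r u
      ... | inj₁ e = ⊥-elim (u≢r e)
      ... | inj₂ (w , refl) = ∈-map⁺ ι (∈-satisfying⁺ {P = b} (subst (λ t → eqF t v ≡ true) (sym pu) (eqF-refl v)))

  ∣children∣ : ∀ v → ∣ children v ∣ ≡ indeg r par v
  ∣children∣ v = trans (∣tabulate∣ (λ y → eqF (q y) v)) (sym (indeg-count v))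

  has-child : ∀ v i → indeg r par v ≡ suc i → Σ (Fin m) λ y → q y ≡ v
  has-child v i e with count-witness {P = λ y → eqF (q y) v} (trans (sym (indeg-count v)) e)
  ... | y , e2 = y , eqF-true e2

  M = siblingMatrix q

  row≡children : ∀ x → lookup M x ≡ children (q x)
  row≡children x = lookup∘tabulate (λ x → children (q x)) x

  -- blocks of size i ↔ vertices of indegree i, via v ↦ children v
  type≡indegrees : ∀ i → 1 ≤ i → blockMult M i ≡ indegMult r par i
  type≡indegrees (suc i) _ = trans
    (unique-≈⇒length-≡ (≡-dec Bool._≟_) (UniqueP.filter⁺ size? (DecUniqueP.deduplicate-! (≡-dec Bool._≟_) (toList M)))
      (map-unique children (UniqueP.filter⁺ indeg? (UniqueP.allFin⁺ _)) children-injective) block⇒children children⇒block)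
    (length-map children (filter indeg? (allFin (suc m))))
    where
      size? = λ (B : Vec Bool m) → ∣ B ∣ ℕ.≟ suc i
      indeg? = λ v → indeg r par v ℕ.≟ suc i
      Internal = filter indeg? (allFin (suc m))
      internal-child : ∀ {v} → v ∈ Internal → Σ (Fin m) λ y → q y ≡ v
      internal-child v∈ = has-child _ i (proj₂ (∈-filter⁻ indeg? {xs = allFin (suc m)} v∈))
      children-injective : ∀ {a b} → a ∈ Internal → b ∈ Internal → children a ≡ children b → a ≡ b
      children-injective {a} {b} a∈ b∈ e with internal-child a∈
      ... | y , refl = eqF-true (trans (sym (lookup∘tabulate (λ y → eqF (q y) b) y))
                         (trans (cong (λ w → lookup w y) (sym e)) (trans (lookup∘tabulate (λ y' → eqF (q y') (q y)) y) (eqF-refl (q y)))))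
      block⇒children : ∀ {B} → B ∈ filter size? (blocks M) → B ∈ map children Internal
      block⇒children {B} B∈ with ∈-filter⁻ size? {xs = blocks M} B∈
      ... | B∈b , sz with ∈-toList⇒lookup M (∈-deduplicate⁻ (≡-dec Bool._≟_) (toList M) B∈b)
      ... | x , refl = subst (_∈ map children Internal) (sym (row≡children x))
          (∈-map⁺ children (∈-filter⁺ indeg? (∈-allFin (q x))
             (trans (sym (∣children∣ (q x))) (trans (cong ∣_∣ (sym (row≡children x))) sz))))
      children⇒block : ∀ {B} → B ∈ map children Internal → B ∈ filter size? (blocks M)
      children⇒block {B} B∈ with ∈-map⁻ children B∈
      ... | v , v∈ , refl with internal-child v∈
      ... | y , refl = ∈-filter⁺ size?
            (∈-deduplicate⁺ (≡-dec Bool._≟_) (subst (_∈ toList M) (row≡children y) (lookup∈toList M y)))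
            (trans (∣children∣ (q y)) (proj₂ (∈-filter⁻ indeg? {xs = allFin (suc m)} v∈)))

vecUnique⇒unique : ∀ {A : Set} {k} {s : Vec A k} → VecUnique.Unique s → Unique (toList s)
vecUnique⇒unique {s = []} VecAllPairs.[] = []
vecUnique⇒unique {s = x ∷ s} (x∉s VecAllPairs.∷ u) = VecAllP.toList⁺ x∉s ∷ vecUnique⇒unique u

unique⇒vecUnique : ∀ {A : Set} {k} {s : Vec A k} → Unique (toList s) → VecUnique.Unique s
unique⇒vecUnique {s = []} _ = VecAllPairs.[]
unique⇒vecUnique {s = x ∷ s} (x∉s ∷ u) = VecAllP.toList⁻ x∉s VecAllPairs.∷ unique⇒vecUnique u

module Bijection (m : ℕ) (r : Fin (suc m)) (λ' : List ℕ) (partition : IsPartitionOf λ' m) where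
  open Vertices m r

  ℓ = length λ'

  relation : Vec (Vec Bool m) m → Fin m → Fin m → Bool
  relation M x y = lookup (lookup M x) y

  isEquiv-from : ∀ {M R} → IsEqR R → (∀ x y → relation M x y ≡ R x y) → IsEquivRel M
  isEquiv-from {M} {R} E MR =
      (λ x → toT (trans (MR x x) (rfl x)))
    , (λ x y t → toT (trans (MR y x) (sy x y (fromMR t))))
    , (λ x y z t1 t2 → toT (trans (MR x z) (tr x y z (fromMR t1) (fromMR t2))))
    where
      open IsEqR E
      fromMR : ∀ {x y} → T (relation M x y) → R x y ≡ true
      fromMR {x} {y} t = trans (sym (MR x y)) (fromT t)

  relation-isEqR : ∀ M → IsEquivRel M → IsEqR (relation M)
  relation-isEqR M (refl′ , sym′ , trans′) = record
    { rfl = λ x → fromT (refl′ x)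
    ; sy = λ x y e → fromT (sym′ x y (toT e))
    ; tr = λ x y z e1 e2 → fromT (trans′ x y z (toT e1) (toT e2)) }

  parentMap : Vec V (suc m) → Fin m → V
  parentMap par y = lookup par (ι y)

  partitionOf : Vec V (suc m) → Vec (Vec Bool m) m
  partitionOf par = siblingMatrix (parentMap par)

  sequenceOf : Vec V (suc m) → Vec V ℓ
  sequenceOf par = Encoding.encode m r (parentMap par) ℓ (λ _ → true)

  unassigned : Fin m → Maybe V
  unassigned _ = nothing

  parentsOf : Vec (Vec Bool m) m → Vec V ℓ → Fin m → V
  parentsOf M p y = fromMaybe r (Decoding.decode m r (relation M) p unassigned y)

  treeOf : Vec (Vec Bool m) m → Vec V ℓ → Vec V (suc m)
  treeOf M p = tabulate (extend (parentsOf M p))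

  module OfTree (par : Vec V (suc m)) (root : lookup par r ≡ r) (reaches : ∀ v → iter (lookup par) (suc m) v ≡ r)
                (type : ∀ i → 1 ≤ i → indegMult r par i ≡ mult i λ') where
    q = parentMap par
    open Encoding m r q

    extend≗par : ∀ v → extend q v ≡ lookup par v
    extend≗par v with ι-or-r v
    ... | inj₁ refl = trans (extend-r q) (sym root)
    ... | inj₂ (w , refl) = extend-ι q w

    tree : ∀ v → iter (extend q) (suc m) v ≡ r
    tree v = trans (iter-cong extend≗par (suc m) v) (reaches v)

    relation≡sibling : ∀ x y → relation (partitionOf par) x y ≡ sibling x y
    relation≡sibling = siblingMatrix-entry q

    partition-type : ∀ i → 1 ≤ i → blockMult (partitionOf par) i ≡ mult i λ'
    partition-type i p = trans (SiblingType.type≡indegrees m r par i p) (type i p)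

    partition-isEquiv : IsEquivRel (partitionOf par)
    partition-isEquiv = isEquiv-from {partitionOf par} sibling-isEqR relation≡sibling

    -- before pruning there are ℓ blocks, one per internal vertex
    initial : EncInv (λ _ → true) ℓ
    initial = record
      { blockwise = λ _ _ _ → refl
      ; blocks-left = BlockCount.leaders-by-type sibling sibling-isEqR (partitionOf par) relation≡sibling
                                                 λ' partition partition-type
      ; parent-closed = λ _ _ _ _ → refl }

    sequence-unique : VecUnique.Unique (sequenceOf par)
    sequence-unique = unique⇒vecUnique (OfTree.encode-unique tree ℓ initial)

    sequence-last : LastIs (sequenceOf par) r
    sequence-last = OfTree.encode-last tree ℓ initial

    treeOf∘encode : treeOf (partitionOf par) (sequenceOf par) ≡ par
    treeOf∘encode = trans (tabulate-cong same) (tabulate∘lookup par)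
      where
        parents≡q : ∀ y → parentsOf (partitionOf par) (sequenceOf par) y ≡ q y
        parents≡q y = cong (fromMaybe r)
          (DecodeEncode.decode-encode m r q tree (relation (partitionOf par)) relation≡sibling
                                      ℓ (λ _ → true) unassigned initial (λ _ → refl) y)
        same : ∀ v → extend (parentsOf (partitionOf par) (sequenceOf par)) v ≡ lookup par v
        same v with ι-or-r v
        ... | inj₁ refl = trans (extend-r _) (sym root)
        ... | inj₂ (w , refl) = trans (extend-ι _ w) (parents≡q w)

  module OfPair (M : Vec (Vec Bool m) m) (isEquiv : IsEquivRel M) (type : ∀ i → 1 ≤ i → blockMult M i ≡ mult i λ')
                (p : Vec V ℓ) (p-unique : VecUnique.Unique p) (p-last : LastIs p r) where
    R = relation M
    E = relation-isEqR M isEquiv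
    open Decoding m r R
    open Correctness E

    initial : DecInv unassigned p
    initial = record
      { blockwise = λ _ _ _ → refl
      ; blocks-left = BlockCount.leaders-by-type R E M (λ _ _ → refl) λ' partition type
      ; upcoming-unassigned = λ _ _ → refl ; used-not-upcoming = λ _ _ () ; same-parent-related = λ _ _ _ ()
      ; unique = vecUnique⇒unique p-unique ; last = p-last }

    final = decode-inv p initial
    Q = parentsOf M p

    decode≡Q : ∀ y → decode p unassigned y ≡ just (Q y)
    decode≡Q y with decode p unassigned y | decode-total final y
    ... | just u | _ = refl

    decoded⇒Q : ∀ y u → decode p unassigned y ≡ just u → Q y ≡ u
    decoded⇒Q y u d = MaybeP.just-injective (trans (sym (decode≡Q y)) d)

    R≡sibling : ∀ x y → R x y ≡ eqF (Q y) (Q x)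
    R≡sibling x y = bool-iff
      (λ rxy → subst (λ t → eqF t (Q x) ≡ true)
                 (MaybeP.just-injective (trans (sym (decode≡Q x)) (trans (DecInv.blockwise final x y rxy) (decode≡Q y))))
                 (eqF-refl (Q x)))
      (λ e → DecInv.same-parent-related final x y (Q x) (decode≡Q x) (trans (decode≡Q y) (cong just (eqF-true e))))

    par = treeOf M p

    parentMap≡Q : ∀ y → parentMap par y ≡ Q y
    parentMap≡Q y = trans (lookup∘tabulate (extend Q) (ι y)) (extend-ι Q y)

    root : lookup par r ≡ r
    root = trans (lookup∘tabulate (extend Q) r) (extend-r Q)

    ℓ≤m : ℓ ≤ m
    ℓ≤m = ≤-trans (≤-reflexive (sym (DecInv.blocks-left initial))) (count-≤ _)

    -- every vertex reaches the root within ℓ ≤ m + 1 steps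
    reaches : ∀ v → iter (lookup par) (suc m) v ≡ r
    reaches v = trans (iter-cong (lookup∘tabulate (extend Q)) (suc m) v) (within-m+1 (ι-or-r v))
      where
        within-m+1 : (v ≡ r ⊎ Σ (Fin m) λ w → v ≡ ι w) → iter (extend Q) (suc m) v ≡ r
        within-m+1 (inj₁ refl) = iter-extend-r Q (suc m)
        within-m+1 (inj₂ (z , refl)) = begin
          iter (extend Q) (suc m) (ι z)
            ≡⟨ cong (λ k → iter (extend Q) k (ι z)) (m+[n∸m]≡n (≤-trans ℓ≤m (n≤1+n m))) ⟨
          iter (extend Q) (ℓ + (suc m ∸ ℓ)) (ι z)
            ≡⟨ iter-+ (extend Q) ℓ (suc m ∸ ℓ) (ι z) ⟩
          iter (extend Q) (suc m ∸ ℓ) (iter (extend Q) ℓ (ι z))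
            ≡⟨ cong (iter (extend Q) (suc m ∸ ℓ)) (decode-reaches-root p Q initial decoded⇒Q z refl) ⟩
          iter (extend Q) (suc m ∸ ℓ) r
            ≡⟨ iter-extend-r Q (suc m ∸ ℓ) ⟩
          r ∎
          where open ≡-Reasoning

    partitionOf∘decode : partitionOf par ≡ M
    partitionOf∘decode = vec-ext (λ x → vec-ext (λ y →
      trans (siblingMatrix-entry (parentMap par) x y)
            (trans (cong₂ eqF (parentMap≡Q y) (parentMap≡Q x)) (sym (R≡sibling x y)))))

    tree-type : ∀ i → 1 ≤ i → indegMult r par i ≡ mult i λ'
    tree-type i pi = trans (sym (SiblingType.type≡indegrees m r par i pi))
                           (trans (cong (λ M → blockMult M i) partitionOf∘decode) (type i pi))

    sequenceOf∘decode : sequenceOf par ≡ p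
    sequenceOf∘decode = EncodeDecode.encode-decode m r R E (parentMap par)
      (λ x y → trans (R≡sibling x y) (sym (cong₂ eqF (parentMap≡Q y) (parentMap≡Q x))))
      p unassigned (λ _ → true) initial (λ y u d → trans (parentMap≡Q y) (decoded⇒Q y u d)) (λ _ → refl)

  encodeTree : Trees (suc m) r λ' → SetPartitions (suc m) λ' × KPerms (suc m) r ℓ
  encodeTree (par , (root , reaches) , type) =
    (partitionOf par , partition-isEquiv , partition-type) , (sequenceOf par , sequence-unique , sequence-last)
    where open OfTree par root reaches type

  decodePair : SetPartitions (suc m) λ' × KPerms (suc m) r ℓ → Trees (suc m) r λ'
  decodePair ((M , isEquiv , type) , (p , p-unique , p-last)) = treeOf M p , (root , reaches) , tree-type
    where open OfPair M isEquiv type p p-unique p-last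

  bijection : Inverse (Trees-setoid (suc m) r λ') (×-setoid (SetPartitions-setoid (suc m) λ') (KPerms-setoid (suc m) r ℓ))
  bijection = record
    { to = encodeTree
    ; from = decodePair
    ; to-cong = λ { refl → refl , refl }
    ; from-cong = λ { (refl , refl) → refl }
    ; inverse = (λ {x} {y} → encode∘decode {x} {y}) , (λ {x} {y} → decode∘encode {x} {y}) }
    where
      encode∘decode : ∀ {x y} → proj₁ y ≡ proj₁ (decodePair x)
                    → (proj₁ (proj₁ (encodeTree y)) ≡ proj₁ (proj₁ x)) × (proj₁ (proj₂ (encodeTree y)) ≡ proj₁ (proj₂ x))
      encode∘decode {(M , isEquiv , type) , (p , p-unique , p-last)} {par , _} refl = partitionOf∘decode , sequenceOf∘decode
        where open OfPair M isEquiv type p p-unique p-last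
      decode∘encode : ∀ {x y} → (proj₁ (proj₁ y) ≡ proj₁ (proj₁ (encodeTree x))) × (proj₁ (proj₂ y) ≡ proj₁ (proj₂ (encodeTree x)))
                    → proj₁ (decodePair y) ≡ proj₁ x
      decode∘encode {par , (root , reaches) , type} {(M , _) , (p , _)} (refl , refl) = treeOf∘encode
        where open OfTree par root reaches type

theorem1p2 : (n : ℕ) → 1 ≤ n → (r : Fin n) → (λ' : List ℕ) → IsPartitionOf λ' (n ∸ 1)
    → Inverse (Trees-setoid n r λ') (×-setoid (SetPartitions-setoid n λ') (KPerms-setoid n r (len λ')))
theorem1p2 zero () r λ' partition
theorem1p2 (suc m) _ r λ' partition = Bijection.bijection m r λ' partition
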